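{- Let $r\ge 2$, $n=2^r$ and $M=2^{n-r}$. There is a one-to-one correspondence (a bijection) between the set of zeroed ENP1CCs of length $n+1$ (which have $M$ codewords) and the set of zeroed diamond codes of length $n+1$ with $2M$ codewords.
   Context: All codes are binary: a code of length $m$ is a subset of $\mathbb{F}_2^m$; $d(\mathbf{x},\mathbf{y})$ is the Hamming distance, and the weight of a word is its number of nonzero coordinates. A code is zeroed if it contains the all-zero word. A nearly perfect 1-covering code (NP1CC) of length $n=2^r$ is a code $\mathcal{C}\subseteq\mathbb{F}_2^n$ with $|\mathcal{C}|=2^{n-r}$ such that every word of $\mathbb{F}_2^n$ is at distance at most $1$ from some codeword. An ENP1CC (extended NP1CC) is a code of length $n+1$ of the form $\{(\mathbf{c},p(\mathbf{c})):\mathbf{c}\in\mathcal{C}\}$ or $\{(\mathbf{c},1+p(\mathbf{c})):\mathbf{c}\in\mathcal{C}\}$ for an NP1CC $\mathcal{C}$, where $p(\mathbf{c})=\sum_i c_i \bmod 2$. A diamond code of length $m$ is a code $\hat{\mathcal{C}}\subseteq\mathbb{F}_2^m$, nonempty with nonempty complement, such that every codeword has exactly $2$ codewords (and hence $m-2$ non-codewords) at distance $1$, and every non-codeword has exactly $1$ codeword (and hence $m-1$ non-codewords) at distance $1$; i.e., it is a completely regular code with quotient matrix $\begin{pmatrix}2 & m-2\\ 1 & m-1\end{pmatrix}$. -}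

module Defs where

open import Data.Bool using (Bool; true; false; not; _xor_; if_then_else_)
open import Data.Nat using (ℕ; zero; suc; _+_; _*_; _∸_; _^_; _≤_)
open import Data.Fin using (Fin)
open import Data.Vec using (Vec; []; _∷_; _∷ʳ_; lookup; replicate; updateAt; foldr)
open import Data.List using (List; map; _++_; allFin) renaming ([] to []ₗ; _∷_ to _∷ₗ_)
open import Data.Product using (Σ; ∃; ∃-syntax; _×_; _,_; proj₁)
open import Function.Bundles using (_⇔_)
open import Relation.Binary.PropositionalEquality using (_≡_; _≢_; refl; sym; trans)
open import Relation.Binary.Bundles using (Setoid)
open import Level using (0ℓ)

-- Words of length m: elements of F₂^m, with F₂ = Bool (false = 0, true = 1).
Word : ℕ → Set
Word m = Vec Bool m

Code : ℕ → Set
Code m = Word m → Bool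

countTrue : List Bool → ℕ
countTrue []ₗ = 0
countTrue (true ∷ₗ bs) = suc (countTrue bs)
countTrue (false ∷ₗ bs) = countTrue bs

allWords : (m : ℕ) → List (Word m)
allWords zero = [] ∷ₗ []ₗ
allWords (suc m) = map (false ∷_) (allWords m) ++ map (true ∷_) (allWords m)

size : ∀ {m} → Code m → ℕ
size {m} C = countTrue (map C (allWords m))

dist : ∀ {m} → Word m → Word m → ℕ
dist {m} x y = countTrue (map (λ i → lookup x i xor lookup y i) (allFin m))

zeroWord : ∀ {m} → Word m
zeroWord = replicate _ false

parity : ∀ {m} → Word m → Bool
parity = foldr _ _xor_ false

Zeroed : ∀ {m} → Code m → Set
Zeroed C = C zeroWord ≡ true

NP1CC : (r : ℕ) → Code (2 ^ r) → Set
NP1CC r C =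
  size C ≡ 2 ^ (2 ^ r ∸ r) ×
  (∀ (x : Word (2 ^ r)) → ∃[ c ] (C c ≡ true × dist x c ≤ 1))

ENP1CC : (r : ℕ) → Code (suc (2 ^ r)) → Set
ENP1CC r D =
  ∃[ C ] ∃[ e ] (NP1CC r C ×
    (∀ (y : Word (suc (2 ^ r))) →
       (D y ≡ true) ⇔ (∃[ c ] (C c ≡ true × y ≡ c ∷ʳ (e xor parity c)))))

-- flip the i-th coordinate of x (the words at distance 1 from x are exactly these)
flipAt : ∀ {m} → Fin m → Word m → Word m
flipAt i x = updateAt x i not

nbrCount : ∀ {m} → Code m → Word m → ℕ
nbrCount {m} D x = countTrue (map (λ i → D (flipAt i x)) (allFin m))

Diamond : (m : ℕ) → Code m → Set
Diamond m D =
  (∃[ x ] D x ≡ true) ×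
  (∃[ x ] D x ≡ false) ×
  (∀ x → D x ≡ true → nbrCount D x ≡ 2) ×
  (∀ x → D x ≡ false → nbrCount D x ≡ 1)

CodeSetoid : (m : ℕ) → (Code m → Set) → Setoid 0ℓ 0ℓ
CodeSetoid m P = record
  { Carrier = Σ (Code m) P
  ; _≈_ = λ A B → ∀ (y : Word m) → proj₁ A y ≡ proj₁ B y
  ; isEquivalence = record
    { refl = λ _ → refl
    ; sym = λ p y → sym (p y)
    ; trans = λ p q y → trans (p y) (q y)
    }
  }

ZeroedENP1CCs : ℕ → Setoid 0ℓ 0ℓ
ZeroedENP1CCs r = CodeSetoid (suc (2 ^ r)) (λ D → ENP1CC r D × Zeroed D)

ZeroedDiamonds : ℕ → Setoid 0ℓ 0ℓ
ZeroedDiamonds r = CodeSetoid (suc (2 ^ r))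
  (λ D → Diamond (suc (2 ^ r)) D × Zeroed D × size D ≡ 2 * 2 ^ (2 ^ r ∸ r))

{-# OPTIONS --safe #-}
-- A zeroed ENP1CC D is an even-weight code with M codewords in which every odd word has a neighbour
-- (an even cover), and it is sent to its diamond completion: D together with the odd words having
-- at least two neighbours in D.  Write surplus y = deg D y ∸ 1 and let surplusAround u be its sum
-- over the neighbours of u.  Double counting gives ∑ surplus = M and ∑ surplusAround = (n + 1) M,
-- which equals 2 ^ n + M because n M = 2 ^ n.  Every even non-codeword has odd, hence positive,
-- surplusAround, and the codewords contribute ∑ deg · surplus ≥ 2 M; these bounds add up to the
-- same 2 ^ n + M, so all of them are tight.  Thus odd words have at most two neighbours in D, even
-- non-codewords have exactly one doubly covered neighbour, and a local argument on 4-cycles shows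
-- that codewords have exactly two: the completion is a diamond code of size 2 M.  Conversely,
-- counting the edges between the codewords of one parity and the non-codewords of a diamond code
-- shows that both parity classes have M codewords, so its even part is a zeroed ENP1CC, and the
-- two constructions are mutually inverse.

module Submission where

open import Defs
open import Data.Nat using (ℕ; _≤_)
open import Function.Bundles using (Bijection)

open import Data.Bool using (Bool; true; false; not; _xor_; _∧_; _∨_)
import Data.Bool.Properties as Bool
open import Data.Nat using (zero; suc; _+_; _*_; _∸_; _^_; _<_; _≤ᵇ_; z≤n; s≤s; z<s)
open import Data.Nat.Properties
open import Data.Nat.Tactic.RingSolver using (solve-∀)
open import Data.Fin using (Fin; fromℕ; inject₁) renaming (zero to fzero; suc to fsuc)
import Data.Fin.Properties as Fin
open import Data.Vec using ([]; _∷_; _∷ʳ_; lookup; initLast)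
import Data.Vec.Properties as Vec
open import Data.Vec.Functional using (updateAt)
open import Data.Vec.Functional.Properties using (updateAt-updates; updateAt-minimal)
import Data.List as List
import Data.List.Properties as List
open import Data.Nat.Divisibility using (_∣_; divides; ∣1⇒≡1; ∣m+n∣m⇒∣n; m∣m*n)
open import Data.Product as Product using (∃-syntax; _×_; _,_; proj₁; proj₂)
open import Data.Sum as Sum using (_⊎_; inj₁; inj₂)
open import Function.Base using (_∘_; const)
open import Function.Bundles using (Equivalence; _⇔_; mk⇔)
open import Function.Properties.Inverse using (Inverse⇒Bijection)
open import Relation.Binary.Bundles using (Setoid)
open import Relation.Binary.PropositionalEquality
open import Relation.Nullary using (yes; no; contradiction)
open import Algebra.Properties.CommutativeSemigroup +-commutativeSemigroup
  using (x∙yz≈y∙xz; xy∙z≈xz∙y; interchange)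
open import Algebra.Properties.Semiring.Sum +-*-semiring
  using (sum; sum-syntax; ∑-distrib-+; sum-cong-≗; *-distribˡ-sum; *-distribʳ-sum)

toℕ : Bool → ℕ
toℕ true = 1
toℕ false = 0

toℕ≤1 : ∀ b → toℕ b ≤ 1
toℕ≤1 true = s≤s z≤n
toℕ≤1 false = z≤n

toℕ-pos : ∀ {b} → 0 < toℕ b → b ≡ true
toℕ-pos {true} _ = refl

toℕ-zero : ∀ {b} → toℕ b ≡ 0 → b ≡ false
toℕ-zero {false} _ = refl

toℕ-not+toℕ : ∀ b → toℕ (not b) + toℕ b ≡ 1
toℕ-not+toℕ true = refl
toℕ-not+toℕ false = refl

toℕ-not*+toℕ* : ∀ b x → toℕ (not b) * x + toℕ b * x ≡ x
toℕ-not*+toℕ* b x = trans (sym (*-distribʳ-+ x (toℕ (not b)) (toℕ b)))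
                          (trans (cong (_* x) (toℕ-not+toℕ b)) (*-identityˡ x))

toℕ-2≤ᵇ : ∀ {x} → x ≤ 2 → toℕ (2 ≤ᵇ x) ≡ x ∸ 1
toℕ-2≤ᵇ {0} _ = refl
toℕ-2≤ᵇ {1} _ = refl
toℕ-2≤ᵇ {2} _ = refl
toℕ-2≤ᵇ {suc (suc (suc _))} (s≤s (s≤s ()))

+-≤-tight : ∀ {x y x₀ y₀} → x₀ ≤ x → y₀ ≤ y → x + y ≤ x₀ + y₀ → x ≡ x₀ × y ≡ y₀
+-≤-tight {x} {y} {x₀} {y₀} x₀≤x y₀≤y x+y≤ =
  ≤-antisym (+-cancelʳ-≤ y₀ x x₀ (≤-trans (+-monoʳ-≤ x y₀≤y) x+y≤)) x₀≤x ,
  ≤-antisym (+-cancelˡ-≤ x₀ y y₀ (≤-trans (+-monoˡ-≤ y x₀≤x) x+y≤)) y₀≤y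

crossed-cancel : ∀ k {a b} → 2 ≤ k → k * a + b ≡ k * b + a → a ≡ b
crossed-cancel (suc zero) (s≤s ()) _
crossed-cancel (suc (suc j)) {a} {b} _ eq = *-cancelˡ-≡ a b (suc j) (+-cancelʳ-≡ (a + b) _ _ (begin
  suc j * a + (a + b)     ≡⟨ peel j a b ⟨
  suc (suc j) * a + b     ≡⟨ eq ⟩
  suc (suc j) * b + a     ≡⟨ peel j b a ⟩
  suc j * b + (b + a)     ≡⟨ cong (suc j * b +_) (+-comm b a) ⟩
  suc j * b + (a + b)     ∎))
  where
  open ≡-Reasoning
  peel : ∀ j a b → suc (suc j) * a + b ≡ suc j * a + (a + b)
  peel = solve-∀

n<2^n : ∀ n → n < 2 ^ n
n<2^n zero = s≤s z≤n
n<2^n (suc n) =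
  subst (_≤ 2 ^ suc n) (+-comm (suc n) 1) (+-mono-≤ (n<2^n n) (≤-trans (m^n>0 2 n) (m≤m+n (2 ^ n) 0)))

2∣2^r : ∀ {r} → 1 ≤ r → 2 ∣ 2 ^ r
2∣2^r {suc r} _ = m∣m*n (2 ^ r)

2^r*2^[2^r∸r]≡2^2^r : ∀ r → 2 ^ r * 2 ^ (2 ^ r ∸ r) ≡ 2 ^ 2 ^ r
2^r*2^[2^r∸r]≡2^2^r r =
  trans (sym (^-distribˡ-+-* 2 r (2 ^ r ∸ r))) (cong (2 ^_) (m+[n∸m]≡n (<⇒≤ (n<2^n r))))

sum-const : ∀ m c → ∑[ i < m ] c ≡ m * c
sum-const zero c = refl
sum-const (suc m) c = cong (c +_) (sum-const m c)

sum-zero : ∀ {m} (g : Fin m → ℕ) → (∀ i → g i ≡ 0) → sum g ≡ 0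
sum-zero {m} g g≗0 = trans (sum-cong-≗ g≗0) (trans (sum-const m 0) (*-zeroʳ m))

sum<m⇒∃≡0 : ∀ {m} (g : Fin m → ℕ) → sum g < m → ∃[ i ] g i ≡ 0
sum<m⇒∃≡0 {suc m} g ∑g<m with g fzero in eq
... | zero = fzero , eq
... | suc k = let i , gi≡0 = sum<m⇒∃≡0 (g ∘ fsuc) (≤-trans (s≤s (m≤n+m _ k)) (≤-pred ∑g<m))
              in fsuc i , gi≡0

sum-pos⇒∃ : ∀ {m} (g : Fin m → ℕ) → 0 < sum g → ∃[ i ] 0 < g i
sum-pos⇒∃ {suc m} g ∑g>0 with g fzero in eq
... | suc _ = fzero , subst (0 <_) (sym eq) z<s
... | zero = let i , gi>0 = sum-pos⇒∃ (g ∘ fsuc) ∑g>0 in fsuc i , gi>0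

sum-symmetric : ∀ {m} (h : Fin m → Fin m → ℕ) → (∀ i j → h i j ≡ h j i) →
  ∃[ k ] ∑[ i < m ] ∑[ j < m ] h i j ≡ ∑[ i < m ] h i i + 2 * k
sum-symmetric {zero} h h-sym = 0 , refl
sum-symmetric {suc m} h h-sym
  with sum-symmetric (λ i j → h (fsuc i) (fsuc j)) (λ i j → h-sym (fsuc i) (fsuc j))
... | k , eq = row + k , (begin
  (h₀₀ + row) + ∑[ i < m ] (h (fsuc i) fzero + ∑[ j < m ] h (fsuc i) (fsuc j))
    ≡⟨ cong ((h₀₀ + row) +_) (∑-distrib-+ (λ i → h (fsuc i) fzero) _) ⟩
  (h₀₀ + row) + (∑[ i < m ] h (fsuc i) fzero + ∑[ i < m ] ∑[ j < m ] h (fsuc i) (fsuc j))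
    ≡⟨ cong₂ (λ c r → (h₀₀ + row) + (c + r)) (sum-cong-≗ (λ i → h-sym (fsuc i) fzero)) eq ⟩
  (h₀₀ + row) + (row + (diag + 2 * k))
    ≡⟨ regroup h₀₀ row diag k ⟩
  (h₀₀ + diag) + 2 * (row + k) ∎)
  where
  open ≡-Reasoning
  h₀₀ = h fzero fzero
  row = ∑[ j < m ] h fzero (fsuc j)
  diag = ∑[ i < m ] h (fsuc i) (fsuc i)
  regroup : ∀ a r d k → (a + r) + (r + (d + 2 * k)) ≡ (a + d) + 2 * (r + k)
  regroup = solve-∀

zeroAt : ∀ {m} → Fin m → (Fin m → ℕ) → Fin m → ℕ
zeroAt i g = updateAt g i (const 0)

sum-zeroAt : ∀ {m} (g : Fin m → ℕ) i → sum g ≡ g i + sum (zeroAt i g)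
sum-zeroAt g fzero = refl
sum-zeroAt g (fsuc i) = trans (cong (g fzero +_) (sum-zeroAt (g ∘ fsuc) i))
                              (x∙yz≈y∙xz (g fzero) (g (fsuc i)) _)

zeroAt-≢ : ∀ {m} (g : Fin m → ℕ) {i k} → k ≢ i → zeroAt i g k ≡ g k
zeroAt-≢ g {i} {k} = updateAt-minimal k i g

zeroAt-≤ : ∀ {m} (g : Fin m → ℕ) i k → zeroAt i g k ≤ g k
zeroAt-≤ g i k with k Fin.≟ i
... | yes refl = subst (_≤ g k) (sym (updateAt-updates k g)) z≤n
... | no k≢i = ≤-reflexive (zeroAt-≢ g k≢i)

zeroAt-pos : ∀ {m} (g : Fin m → ℕ) {i k} → 0 < zeroAt i g k → k ≢ i × 0 < g k
zeroAt-pos g {i} {k} pos = k≢i , subst (0 <_) (zeroAt-≢ g k≢i) pos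
  where
  k≢i : k ≢ i
  k≢i refl = contradiction (subst (0 <_) (updateAt-updates k g) pos) λ ()

≤-sum : ∀ {m} (g : Fin m → ℕ) i → g i ≤ sum g
≤-sum g i = subst (g i ≤_) (sym (sum-zeroAt g i)) (m≤m+n (g i) _)

<-sum-zeroAt : ∀ {m} (g : Fin m → ℕ) i {c} → g i + c < sum g → c < sum (zeroAt i g)
<-sum-zeroAt g i {c} lt = +-cancelˡ-< (g i) c _ (subst (g i + c <_) (sum-zeroAt g i) lt)

sum>⇒∃-other : ∀ {m} (g : Fin m → ℕ) i → g i < sum g → ∃[ k ] k ≢ i × 0 < g k
sum>⇒∃-other g i lt =
  let k , pos = sum-pos⇒∃ (zeroAt i g) (<-sum-zeroAt g i (subst (_< sum g) (sym (+-identityʳ (g i))) lt))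
  in k , zeroAt-pos g pos

sum>⇒∃-third : ∀ {m} (g : Fin m → ℕ) i j → g i + g j < sum g → ∃[ k ] k ≢ i × k ≢ j × 0 < g k
sum>⇒∃-third g i j lt =
  let k , k≢j , pos = sum>⇒∃-other (zeroAt i g) j
                        (≤-trans (s≤s (zeroAt-≤ g i j)) (<-sum-zeroAt g i lt))
      k≢i , gk>0 = zeroAt-pos g pos
  in k , k≢i , k≢j , gk>0

sum-≥-pair : ∀ {m} (g : Fin m → ℕ) {i j} → j ≢ i → g i + g j ≤ sum g
sum-≥-pair g {i} {j} j≢i = begin
  g i + g j              ≡⟨ cong (g i +_) (zeroAt-≢ g j≢i) ⟨
  g i + zeroAt i g j     ≤⟨ +-monoʳ-≤ (g i) (≤-sum (zeroAt i g) j) ⟩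
  g i + sum (zeroAt i g) ≡⟨ sum-zeroAt g i ⟨
  sum g                  ∎
  where open ≤-Reasoning

sum-≥-triple : ∀ {m} (g : Fin m → ℕ) {i j k} → j ≢ i → k ≢ i → k ≢ j →
               g i + (g j + g k) ≤ sum g
sum-≥-triple g {i} {j} {k} j≢i k≢i k≢j = begin
  g i + (g j + g k)                   ≡⟨ cong (g i +_) (cong₂ _+_ (zeroAt-≢ g j≢i) (zeroAt-≢ g k≢i)) ⟨
  g i + (zeroAt i g j + zeroAt i g k) ≤⟨ +-monoʳ-≤ (g i) (sum-≥-pair (zeroAt i g) k≢j) ⟩
  g i + sum (zeroAt i g)              ≡⟨ sum-zeroAt g i ⟨
  sum g                               ∎
  where open ≤-Reasoning

∑W : ∀ m → (Word m → ℕ) → ℕ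
∑W zero f = f []
∑W (suc m) f = ∑W m (λ x → f (false ∷ x)) + ∑W m (λ x → f (true ∷ x))

∑W-cong : ∀ m {f g : Word m → ℕ} → (∀ x → f x ≡ g x) → ∑W m f ≡ ∑W m g
∑W-cong zero f≗g = f≗g []
∑W-cong (suc m) f≗g = cong₂ _+_ (∑W-cong m (f≗g ∘ (false ∷_))) (∑W-cong m (f≗g ∘ (true ∷_)))

∑W-distrib-+ : ∀ m (f g : Word m → ℕ) → ∑W m (λ x → f x + g x) ≡ ∑W m f + ∑W m g
∑W-distrib-+ zero f g = refl
∑W-distrib-+ (suc m) f g =
  trans (cong₂ _+_ (∑W-distrib-+ m (f ∘ (false ∷_)) (g ∘ (false ∷_)))
                   (∑W-distrib-+ m (f ∘ (true ∷_)) (g ∘ (true ∷_))))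
        (interchange (∑W m (f ∘ (false ∷_))) (∑W m (g ∘ (false ∷_)))
                     (∑W m (f ∘ (true ∷_))) (∑W m (g ∘ (true ∷_))))

∑W-*ˡ : ∀ m c (f : Word m → ℕ) → ∑W m (λ x → c * f x) ≡ c * ∑W m f
∑W-*ˡ zero c f = refl
∑W-*ˡ (suc m) c f = trans (cong₂ _+_ (∑W-*ˡ m c (f ∘ (false ∷_))) (∑W-*ˡ m c (f ∘ (true ∷_))))
                          (sym (*-distribˡ-+ c _ _))

∑W-const : ∀ m c → ∑W m (λ _ → c) ≡ 2 ^ m * c
∑W-const zero c = sym (+-identityʳ c)
∑W-const (suc m) c = trans (cong₂ _+_ (∑W-const m c) (∑W-const m c)) (double (2 ^ m) c)
  where
  double : ∀ a c → a * c + a * c ≡ 2 * a * c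
  double = solve-∀

∑W-mono-≤ : ∀ m {f g : Word m → ℕ} → (∀ x → g x ≤ f x) → ∑W m g ≤ ∑W m f
∑W-mono-≤ zero g≤f = g≤f []
∑W-mono-≤ (suc m) g≤f =
  +-mono-≤ (∑W-mono-≤ m (g≤f ∘ (false ∷_))) (∑W-mono-≤ m (g≤f ∘ (true ∷_)))

∑W-tight : ∀ m {f g : Word m → ℕ} → (∀ x → g x ≤ f x) → ∑W m f ≤ ∑W m g →
           ∀ x → f x ≡ g x
∑W-tight zero g≤f ∑f≤∑g [] = ≤-antisym ∑f≤∑g (g≤f [])
∑W-tight (suc m) g≤f ∑f≤∑g (b ∷ x) with +-≤-tight (∑W-mono-≤ m (g≤f ∘ (false ∷_)))
                                                  (∑W-mono-≤ m (g≤f ∘ (true ∷_))) ∑f≤∑g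
... | ∑₀≡ , ∑₁≡ with b
...   | false = ∑W-tight m (g≤f ∘ (false ∷_)) (≤-reflexive ∑₀≡) x
...   | true = ∑W-tight m (g≤f ∘ (true ∷_)) (≤-reflexive ∑₁≡) x

∑W-+-tight : ∀ m {f f₀ g g₀ : Word m → ℕ} → (∀ x → f₀ x ≤ f x) → (∀ x → g₀ x ≤ g x) →
             ∑W m f + ∑W m g ≡ ∑W m f₀ + ∑W m g₀ → ∀ x → f x ≡ f₀ x × g x ≡ g₀ x
∑W-+-tight m f₀≤f g₀≤g ∑≡ x =
  let ∑f≡ , ∑g≡ = +-≤-tight (∑W-mono-≤ m f₀≤f) (∑W-mono-≤ m g₀≤g) (≤-reflexive ∑≡)
  in ∑W-tight m f₀≤f (≤-reflexive ∑f≡) x , ∑W-tight m g₀≤g (≤-reflexive ∑g≡) x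

∑W-sum-comm : ∀ m {k} (h : Word m → Fin k → ℕ) →
              ∑W m (λ x → ∑[ i < k ] h x i) ≡ ∑[ i < k ] ∑W m (λ x → h x i)
∑W-sum-comm zero h = refl
∑W-sum-comm (suc m) h =
  trans (cong₂ _+_ (∑W-sum-comm m (h ∘ (false ∷_))) (∑W-sum-comm m (h ∘ (true ∷_))))
        (sym (∑-distrib-+ (λ i → ∑W m (λ x → h (false ∷ x) i))
                          (λ i → ∑W m (λ x → h (true ∷ x) i))))

∑W-flipAt : ∀ m (i : Fin m) (f : Word m → ℕ) → ∑W m (f ∘ flipAt i) ≡ ∑W m f
∑W-flipAt (suc m) fzero f = +-comm (∑W m (f ∘ (true ∷_))) (∑W m (f ∘ (false ∷_)))
∑W-flipAt (suc m) (fsuc i) f =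
  cong₂ _+_ (∑W-flipAt m i (f ∘ (false ∷_))) (∑W-flipAt m i (f ∘ (true ∷_)))

∑W-∷ʳ : ∀ m (f : Word (suc m) → ℕ) →
        ∑W (suc m) f ≡ ∑W m (λ c → f (c ∷ʳ false) + f (c ∷ʳ true))
∑W-∷ʳ zero f = refl
∑W-∷ʳ (suc m) f = cong₂ _+_ (∑W-∷ʳ m (f ∘ (false ∷_))) (∑W-∷ʳ m (f ∘ (true ∷_)))

∑W-parity : ∀ m π → ∑W (suc m) (λ x → toℕ (π xor parity x)) ≡ 2 ^ m
∑W-parity m π = begin
  ∑W m (λ x → toℕ (π xor parity x)) + ∑W m (λ x → toℕ (π xor not (parity x)))
    ≡⟨ ∑W-distrib-+ m _ _ ⟨
  ∑W m (λ x → toℕ (π xor parity x) + toℕ (π xor not (parity x)))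
    ≡⟨ ∑W-cong m (λ x → one-of-two π (parity x)) ⟩
  ∑W m (λ _ → 1)
    ≡⟨ trans (∑W-const m 1) (*-identityʳ _) ⟩
  2 ^ m ∎
  where
  open ≡-Reasoning
  one-of-two : ∀ π p → toℕ (π xor p) + toℕ (π xor not p) ≡ 1
  one-of-two false false = refl
  one-of-two false true = refl
  one-of-two true false = refl
  one-of-two true true = refl

countTrue-∷ : ∀ b bs → countTrue (b List.∷ bs) ≡ toℕ b + countTrue bs
countTrue-∷ true bs = refl
countTrue-∷ false bs = refl

countTrue-++ : ∀ bs cs → countTrue (bs List.++ cs) ≡ countTrue bs + countTrue cs
countTrue-++ List.[] cs = refl
countTrue-++ (b List.∷ bs) cs = trans (countTrue-∷ b (bs List.++ cs))
  (trans (cong (toℕ b +_) (countTrue-++ bs cs))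
         (trans (sym (+-assoc (toℕ b) _ _)) (cong (_+ countTrue cs) (sym (countTrue-∷ b bs)))))

countTrue-tabulate : ∀ {m} (f : Fin m → Bool) → countTrue (List.tabulate f) ≡ ∑[ i < m ] toℕ (f i)
countTrue-tabulate {zero} f = refl
countTrue-tabulate {suc m} f =
  trans (countTrue-∷ (f fzero) _) (cong (toℕ (f fzero) +_) (countTrue-tabulate (f ∘ fsuc)))

countTrue-allFin : ∀ {m} (f : Fin m → Bool) →
                   countTrue (List.map f (List.allFin m)) ≡ ∑[ i < m ] toℕ (f i)
countTrue-allFin f = trans (cong countTrue (List.map-tabulate (λ i → i) f)) (countTrue-tabulate f)

countTrue-allWords : ∀ m (f : Word m → Bool) → countTrue (List.map f (allWords m)) ≡ ∑W m (toℕ ∘ f)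
countTrue-allWords zero f = trans (countTrue-∷ (f []) List.[]) (+-identityʳ (toℕ (f [])))
countTrue-allWords (suc m) f = begin
  countTrue (List.map f (List.map (false ∷_) ws List.++ List.map (true ∷_) ws))
    ≡⟨ cong countTrue (List.map-++ f (List.map (false ∷_) ws) _) ⟩
  countTrue (List.map f (List.map (false ∷_) ws) List.++ List.map f (List.map (true ∷_) ws))
    ≡⟨ countTrue-++ (List.map f (List.map (false ∷_) ws)) _ ⟩
  countTrue (List.map f (List.map (false ∷_) ws)) + countTrue (List.map f (List.map (true ∷_) ws))
    ≡⟨ cong₂ _+_ (cong countTrue (List.map-∘ ws)) (cong countTrue (List.map-∘ ws)) ⟨
  countTrue (List.map (f ∘ (false ∷_)) ws) + countTrue (List.map (f ∘ (true ∷_)) ws)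
    ≡⟨ cong₂ _+_ (countTrue-allWords m (f ∘ (false ∷_))) (countTrue-allWords m (f ∘ (true ∷_))) ⟩
  ∑W (suc m) (toℕ ∘ f) ∎
  where
  open ≡-Reasoning
  ws = allWords m

size≡∑W : ∀ {m} (C : Code m) → size C ≡ ∑W m (toℕ ∘ C)
size≡∑W {m} = countTrue-allWords m

size-cong : ∀ {m} {C C′ : Code m} → (∀ y → C y ≡ C′ y) → size C ≡ size C′
size-cong {m} {C} {C′} C≗C′ =
  trans (size≡∑W C) (trans (∑W-cong m (cong toℕ ∘ C≗C′)) (sym (size≡∑W C′)))

parity-flipAt : ∀ {m} (i : Fin m) (x : Word m) → parity (flipAt i x) ≡ not (parity x)
parity-flipAt fzero (b ∷ x) = sym (Bool.not-distribˡ-xor b (parity x))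
parity-flipAt (fsuc i) (b ∷ x) =
  trans (cong (b xor_) (parity-flipAt i x)) (sym (Bool.not-distribʳ-xor b (parity x)))

parity-flipAt-≡ : ∀ {m} (i : Fin m) (x : Word m) {p} → parity x ≡ p → parity (flipAt i x) ≡ not p
parity-flipAt-≡ i x refl = parity-flipAt i x

data ParityView {m} (y : Word m) : Set where
  even : parity y ≡ false → ParityView y
  odd : parity y ≡ true → ParityView y

parityView : ∀ {m} (y : Word m) → ParityView y
parityView y with parity y in p
... | false = even p
... | true = odd p

flipAt-involutive : ∀ {m} (i : Fin m) (x : Word m) → flipAt i (flipAt i x) ≡ x
flipAt-involutive i x =
  trans (Vec.updateAt-updateAt i x) (trans (Vec.updateAt-cong i Bool.not-involutive x) (Vec.updateAt-id i x))

flipAt-comm : ∀ {m} (i j : Fin m) (x : Word m) → flipAt i (flipAt j x) ≡ flipAt j (flipAt i x)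
flipAt-comm i j x with i Fin.≟ j
... | yes refl = refl
... | no i≢j = Vec.updateAt-commutes i j i≢j x

parity-∷ʳ : ∀ {m} (c : Word m) b → parity (c ∷ʳ b) ≡ parity c xor b
parity-∷ʳ [] b = Bool.xor-identityʳ b
parity-∷ʳ (a ∷ c) b = trans (cong (a xor_) (parity-∷ʳ c b)) (sym (Bool.xor-assoc a (parity c) b))

parity-zeroWord : ∀ m → parity (zeroWord {m}) ≡ false
parity-zeroWord zero = refl
parity-zeroWord (suc m) = parity-zeroWord m

zeroWord-∷ʳ : ∀ m → zeroWord {suc m} ≡ zeroWord {m} ∷ʳ false
zeroWord-∷ʳ zero = refl
zeroWord-∷ʳ (suc m) = cong (false ∷_) (zeroWord-∷ʳ m)

fromℕ-or-inject₁ : ∀ {m} (i : Fin (suc m)) → i ≡ fromℕ m ⊎ ∃[ j ] i ≡ inject₁ j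
fromℕ-or-inject₁ {m} i with m ≟ Data.Fin.toℕ i
... | yes m≡i = inj₁ (Fin.toℕ-injective (trans (sym m≡i) (sym (Fin.toℕ-fromℕ m))))
... | no m≢i = inj₂ (Data.Fin.lower₁ i m≢i , sym (Fin.inject₁-lower₁ i m≢i))

flipAt-fromℕ-∷ʳ : ∀ {m} (c : Word m) b → flipAt (fromℕ m) (c ∷ʳ b) ≡ c ∷ʳ not b
flipAt-fromℕ-∷ʳ [] b = refl
flipAt-fromℕ-∷ʳ (a ∷ c) b = cong (a ∷_) (flipAt-fromℕ-∷ʳ c b)

flipAt-inject₁-∷ʳ : ∀ {m} (j : Fin m) (c : Word m) b →
                    flipAt (inject₁ j) (c ∷ʳ b) ≡ flipAt j c ∷ʳ b
flipAt-inject₁-∷ʳ fzero (a ∷ c) b = refl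
flipAt-inject₁-∷ʳ (fsuc j) (a ∷ c) b = cong (a ∷_) (flipAt-inject₁-∷ʳ j c b)

dist-∷ : ∀ {m} a b (x y : Word m) → dist (a ∷ x) (b ∷ y) ≡ toℕ (a xor b) + dist x y
dist-∷ a b x y =
  trans (countTrue-allFin (λ i → lookup (a ∷ x) i xor lookup (b ∷ y) i))
        (cong (toℕ (a xor b) +_) (sym (countTrue-allFin (λ i → lookup x i xor lookup y i))))

dist-self : ∀ {m} (x : Word m) → dist x x ≡ 0
dist-self [] = refl
dist-self (a ∷ x) = trans (dist-∷ a a x x) (cong₂ _+_ (cong toℕ (Bool.xor-same a)) (dist-self x))

dist-flipAt : ∀ {m} (i : Fin m) (x : Word m) → dist x (flipAt i x) ≡ 1
dist-flipAt fzero (a ∷ x) =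
  trans (dist-∷ a (not a) x x) (cong₂ _+_ (cong toℕ (Bool.xor-inverseʳ a)) (dist-self x))
dist-flipAt (fsuc i) (a ∷ x) =
  trans (dist-∷ a a x (flipAt i x)) (cong₂ _+_ (cong toℕ (Bool.xor-same a)) (dist-flipAt i x))

dist≡0⇒≡ : ∀ {m} (x y : Word m) → dist x y ≡ 0 → y ≡ x
dist≡0⇒≡ [] [] _ = refl
dist≡0⇒≡ (a ∷ x) (b ∷ y) d≡0 = go a b (trans (sym (dist-∷ a b x y)) d≡0)
  where
  go : ∀ a b → toℕ (a xor b) + dist x y ≡ 0 → b ∷ y ≡ a ∷ x
  go false false d≡0 = cong (false ∷_) (dist≡0⇒≡ x y d≡0)
  go true true d≡0 = cong (true ∷_) (dist≡0⇒≡ x y d≡0)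

dist≤1⇒ : ∀ {m} (x y : Word m) → dist x y ≤ 1 → y ≡ x ⊎ ∃[ i ] y ≡ flipAt i x
dist≤1⇒ [] [] _ = inj₁ refl
dist≤1⇒ (a ∷ x) (b ∷ y) d≤1 = go a b (subst (_≤ 1) (dist-∷ a b x y) d≤1)
  where
  go : ∀ a b → toℕ (a xor b) + dist x y ≤ 1 →
       b ∷ y ≡ a ∷ x ⊎ ∃[ i ] b ∷ y ≡ flipAt i (a ∷ x)
  go false true (s≤s d≤0) = inj₂ (fzero , cong (true ∷_) (dist≡0⇒≡ x y (n≤0⇒n≡0 d≤0)))
  go true false (s≤s d≤0) = inj₂ (fzero , cong (false ∷_) (dist≡0⇒≡ x y (n≤0⇒n≡0 d≤0)))
  go false false d≤1 = Sum.map (cong (false ∷_)) (Product.map fsuc (cong (false ∷_))) (dist≤1⇒ x y d≤1)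
  go true true d≤1 = Sum.map (cong (true ∷_)) (Product.map fsuc (cong (true ∷_))) (dist≤1⇒ x y d≤1)

-- Double counting on the hypercube

nbrSum : ∀ {m} → (Word m → ℕ) → Word m → ℕ
nbrSum {m} g x = ∑[ i < m ] g (flipAt i x)

deg : ∀ {m} → Code m → Word m → ℕ
deg C = nbrSum (toℕ ∘ C)

nbrCount≡deg : ∀ {m} (C : Code m) x → nbrCount C x ≡ deg C x
nbrCount≡deg C x = countTrue-allFin (λ i → C (flipAt i x))

nbrSum-not+deg : ∀ {m} (C : Code m) y → nbrSum (toℕ ∘ not ∘ C) y + deg C y ≡ m
nbrSum-not+deg {m} C y = begin
  nbrSum (toℕ ∘ not ∘ C) y + deg C y
    ≡⟨ ∑-distrib-+ (λ i → toℕ (not (C (flipAt i y)))) _ ⟨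
  ∑[ i < m ] (toℕ (not (C (flipAt i y))) + toℕ (C (flipAt i y)))
    ≡⟨ sum-cong-≗ (λ i → toℕ-not+toℕ (C (flipAt i y))) ⟩
  ∑[ i < m ] 1
    ≡⟨ trans (sum-const m 1) (*-identityʳ m) ⟩
  m ∎
  where open ≡-Reasoning

∑W-nbrSum : ∀ m (g : Word m → ℕ) → ∑W m (nbrSum g) ≡ m * ∑W m g
∑W-nbrSum m g = begin
  ∑W m (nbrSum g)                ≡⟨ ∑W-sum-comm m (λ x i → g (flipAt i x)) ⟩
  ∑[ i < m ] ∑W m (g ∘ flipAt i) ≡⟨ sum-cong-≗ (λ i → ∑W-flipAt m i g) ⟩
  ∑[ i < m ] ∑W m g              ≡⟨ sum-const m (∑W m g) ⟩
  m * ∑W m g                     ∎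
  where open ≡-Reasoning

∑W-*-nbrSum : ∀ m (f g : Word m → ℕ) →
              ∑W m (λ x → f x * nbrSum g x) ≡ ∑W m (λ x → nbrSum f x * g x)
∑W-*-nbrSum m f g = begin
  ∑W m (λ x → f x * nbrSum g x)
    ≡⟨ ∑W-cong m (λ x → *-distribˡ-sum (f x) (λ i → g (flipAt i x))) ⟩
  ∑W m (λ x → ∑[ i < m ] (f x * g (flipAt i x)))
    ≡⟨ ∑W-sum-comm m (λ x i → f x * g (flipAt i x)) ⟩
  ∑[ i < m ] ∑W m (λ x → f x * g (flipAt i x))
    ≡⟨ sum-cong-≗ reverse-edges ⟩
  ∑[ i < m ] ∑W m (λ x → f (flipAt i x) * g x)
    ≡⟨ ∑W-sum-comm m (λ x i → f (flipAt i x) * g x) ⟨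
  ∑W m (λ x → ∑[ i < m ] (f (flipAt i x) * g x))
    ≡⟨ ∑W-cong m (λ x → *-distribʳ-sum (g x) (λ i → f (flipAt i x))) ⟨
  ∑W m (λ x → nbrSum f x * g x) ∎
  where
  open ≡-Reasoning
  reverse-edges : ∀ i → ∑W m (λ x → f x * g (flipAt i x)) ≡ ∑W m (λ x → f (flipAt i x) * g x)
  reverse-edges i = trans (sym (∑W-flipAt m i (λ x → f x * g (flipAt i x))))
                          (∑W-cong m (λ x → cong (λ y → f (flipAt i x) * g y) (flipAt-involutive i x)))

nbrSum-nbrSum : ∀ {m} (g : Word m → ℕ) x → ∃[ k ] nbrSum (nbrSum g) x ≡ m * g x + 2 * k
nbrSum-nbrSum {m} g x =
  let k , eq = sum-symmetric (λ i j → g (flipAt j (flipAt i x))) (λ i j → cong g (flipAt-comm j i x))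
  in k , trans eq (cong (_+ 2 * k) (trans (sum-cong-≗ (λ i → cong g (flipAt-involutive i x)))
                                          (sum-const m (g x))))

Diamond⇒deg : ∀ {m} {C : Code m} → Diamond m C → ∀ y → deg C y ≡ suc (toℕ (C y))
Diamond⇒deg {C = C} (_ , _ , deg∈ , deg∉) y with C y in y∈?
... | true = trans (sym (nbrCount≡deg C y)) (deg∈ y y∈?)
... | false = trans (sym (nbrCount≡deg C y)) (deg∉ y y∈?)

deg⇒Diamond : ∀ {m} {C : Code m} → (∃[ x ] C x ≡ true) → (∃[ x ] C x ≡ false) →
              (∀ y → deg C y ≡ suc (toℕ (C y))) → Diamond m C
deg⇒Diamond {C = C} ∃∈ ∃∉ deg≡ =
  ∃∈ , ∃∉ ,
  (λ y y∈ → trans (nbrCount≡deg C y) (trans (deg≡ y) (cong (suc ∘ toℕ) y∈))) ,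
  (λ y y∉ → trans (nbrCount≡deg C y) (trans (deg≡ y) (cong (suc ∘ toℕ) y∉)))

EvenCode : ∀ {m} → Code m → Set
EvenCode C = ∀ y → C y ≡ true → parity y ≡ false

evenPart : ∀ {m} → Code m → Code m
evenPart C y = C y ∧ not (parity y)

diamondOf : ∀ {m} → Code m → Code m
diamondOf C y = C y ∨ (2 ≤ᵇ deg C y)

evenPart-cong : ∀ {m} {C C′ : Code m} → (∀ y → C y ≡ C′ y) →
                ∀ y → evenPart C y ≡ evenPart C′ y
evenPart-cong C≗C′ y = cong (_∧ not (parity y)) (C≗C′ y)

diamondOf-cong : ∀ {m} {C C′ : Code m} → (∀ y → C y ≡ C′ y) →
                 ∀ y → diamondOf C y ≡ diamondOf C′ y
diamondOf-cong C≗C′ y =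
  cong₂ (λ b d → b ∨ (2 ≤ᵇ d)) (C≗C′ y) (sum-cong-≗ (λ i → cong toℕ (C≗C′ (flipAt i y))))

odd⇒∉ : ∀ {m} {C : Code m} → EvenCode C → ∀ y → parity y ≡ true → C y ≡ false
odd⇒∉ {C = C} C-even y y-odd with C y in y∈C
... | true = contradiction (trans (sym y-odd) (C-even y y∈C)) λ ()
... | false = refl

deg-even : ∀ {m} {C : Code m} → EvenCode C → ∀ y → parity y ≡ false → deg C y ≡ 0
deg-even {C = C} C-even y y-even =
  sum-zero (λ i → toℕ (C (flipAt i y))) (λ i → cong toℕ (odd⇒∉ C-even _ (parity-flipAt-≡ i y y-even)))

diamondOf-even : ∀ {m} {C : Code m} → EvenCode C → ∀ y → parity y ≡ false → diamondOf C y ≡ C y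
diamondOf-even {C = C} C-even y y-even =
  trans (cong (λ d → C y ∨ (2 ≤ᵇ d)) (deg-even C-even y y-even)) (Bool.∨-identityʳ (C y))

evenPart-even : ∀ {m} {C : Code m} y → parity y ≡ false → evenPart C y ≡ C y
evenPart-even {C = C} y p rewrite p = Bool.∧-identityʳ (C y)

evenPart-odd : ∀ {m} {C : Code m} y → parity y ≡ true → evenPart C y ≡ false
evenPart-odd {C = C} y p rewrite p = Bool.∧-zeroʳ (C y)

evenPart-isEven : ∀ {m} {C : Code m} → EvenCode (evenPart C)
evenPart-isEven {C = C} y y∈ with parityView y
... | even p = p
... | odd p = contradiction (trans (sym y∈) (evenPart-odd {C = C} y p)) λ ()

deg-evenPart-odd : ∀ {m} {C : Code m} y → parity y ≡ true → deg (evenPart C) y ≡ deg C y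
deg-evenPart-odd {C = C} y y-odd =
  sum-cong-≗ (λ i → cong toℕ (evenPart-even {C = C} (flipAt i y) (parity-flipAt-≡ i y y-odd)))

evenPart-diamondOf : ∀ {m} {C : Code m} → EvenCode C → ∀ y → evenPart (diamondOf C) y ≡ C y
evenPart-diamondOf {C = C} C-even y with parityView y
... | even p = trans (evenPart-even {C = diamondOf C} y p) (diamondOf-even C-even y p)
... | odd p = trans (evenPart-odd {C = diamondOf C} y p) (sym (odd⇒∉ C-even y p))

diamondOf-evenPart : ∀ {m} {C : Code m} → (∀ y → deg C y ≡ suc (toℕ (C y))) →
                     ∀ y → diamondOf (evenPart C) y ≡ C y
diamondOf-evenPart {C = C} deg≡ y with parityView y
... | even p = trans (diamondOf-even {C = evenPart C} evenPart-isEven y p) (evenPart-even {C = C} y p)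
... | odd p = begin
  evenPart C y ∨ (2 ≤ᵇ deg (evenPart C) y)
    ≡⟨ cong₂ (λ b d → b ∨ (2 ≤ᵇ d)) (evenPart-odd {C = C} y p) (deg-evenPart-odd {C = C} y p) ⟩
  2 ≤ᵇ deg C y
    ≡⟨ cong (2 ≤ᵇ_) (deg≡ y) ⟩
  2 ≤ᵇ suc (toℕ (C y))
    ≡⟨ 2≤ᵇ1+toℕ (C y) ⟩
  C y ∎
  where
  open ≡-Reasoning
  2≤ᵇ1+toℕ : ∀ b → (2 ≤ᵇ suc (toℕ b)) ≡ b
  2≤ᵇ1+toℕ true = refl
  2≤ᵇ1+toℕ false = refl

-- Zeroed ENP1CCs are exactly the even covers

record IsEvenCover (n M : ℕ) (C : Code (suc n)) : Set where
  field
    codewords-even : EvenCode C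
    size≡ : size C ≡ M
    covers-odd : ∀ y → parity y ≡ true → ∃[ i ] C (flipAt i y) ≡ true

-- For an even code this is the usual puncturing, which deletes the last coordinate.
puncture : ∀ {n} → Code (suc n) → Code n
puncture C c = C (c ∷ʳ parity c)

Covering : ∀ {n} → Code n → Set
Covering C = ∀ x → ∃[ c ] (C c ≡ true × dist x c ≤ 1)

parity-evenExt : ∀ {n} (c : Word n) → parity (c ∷ʳ parity c) ≡ false
parity-evenExt c = trans (parity-∷ʳ c (parity c)) (Bool.xor-same (parity c))

parity-oddExt : ∀ {n} (c : Word n) → parity (c ∷ʳ not (parity c)) ≡ true
parity-oddExt c = trans (parity-∷ʳ c (not (parity c))) (Bool.xor-inverseʳ (parity c))

last-of-even : ∀ {n} (c : Word n) b → parity (c ∷ʳ b) ≡ false → b ≡ parity c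
last-of-even c b cb-even = go (parity c) b (trans (sym (parity-∷ʳ c b)) cb-even)
  where
  go : ∀ p b → p xor b ≡ false → b ≡ p
  go false false _ = refl
  go true true _ = refl

last-of-odd : ∀ {n} (c : Word n) b → parity (c ∷ʳ b) ≡ true → b ≡ not (parity c)
last-of-odd c b cb-odd = go (parity c) b (trans (sym (parity-∷ʳ c b)) cb-odd)
  where
  go : ∀ p b → p xor b ≡ true → b ≡ not p
  go false true _ = refl
  go true false _ = refl

flipAt-fromℕ-oddExt : ∀ {n} (x : Word n) → flipAt (fromℕ n) (x ∷ʳ not (parity x)) ≡ x ∷ʳ parity x
flipAt-fromℕ-oddExt x = trans (flipAt-fromℕ-∷ʳ x _) (cong (x ∷ʳ_) (Bool.not-involutive (parity x)))

flipAt-inject₁-oddExt : ∀ {n} (j : Fin n) (x : Word n) →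
  flipAt (inject₁ j) (x ∷ʳ not (parity x)) ≡ flipAt j x ∷ʳ parity (flipAt j x)
flipAt-inject₁-oddExt j x =
  trans (flipAt-inject₁-∷ʳ j x _) (cong (flipAt j x ∷ʳ_) (sym (parity-flipAt j x)))

module _ {n} {C : Code (suc n)} (C-even : EvenCode C) where

  size-puncture : size (puncture C) ≡ size C
  size-puncture = begin
    size (puncture C)                                            ≡⟨ size≡∑W (puncture C) ⟩
    ∑W n (toℕ ∘ puncture C)                                      ≡⟨ ∑W-cong n split-last ⟨
    ∑W n (λ c → toℕ (C (c ∷ʳ false)) + toℕ (C (c ∷ʳ true)))      ≡⟨ ∑W-∷ʳ n (toℕ ∘ C) ⟨
    ∑W (suc n) (toℕ ∘ C)                                         ≡⟨ size≡∑W C ⟨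
    size C                                                       ∎
    where
    open ≡-Reasoning
    split-last : ∀ c → toℕ (C (c ∷ʳ false)) + toℕ (C (c ∷ʳ true)) ≡ toℕ (puncture C c)
    split-last c = begin
      toℕ (C (c ∷ʳ false)) + toℕ (C (c ∷ʳ true))         ≡⟨ both-parities c ⟩
      toℕ (puncture C c) + toℕ (C (c ∷ʳ not (parity c))) ≡⟨ cong (λ b → toℕ (puncture C c) + toℕ b)
                                                                 (odd⇒∉ C-even _ (parity-oddExt c)) ⟩
      toℕ (puncture C c) + 0                              ≡⟨ +-identityʳ _ ⟩
      toℕ (puncture C c)                                  ∎
      where
      both-parities : ∀ c → toℕ (C (c ∷ʳ false)) + toℕ (C (c ∷ʳ true)) ≡
                            toℕ (C (c ∷ʳ parity c)) + toℕ (C (c ∷ʳ not (parity c)))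
      both-parities c with parity c
      ... | false = refl
      ... | true = +-comm (toℕ (C (c ∷ʳ false))) (toℕ (C (c ∷ʳ true)))

  covers-odd⇒Covering : (∀ y → parity y ≡ true → ∃[ i ] C (flipAt i y) ≡ true) → Covering (puncture C)
  covers-odd⇒Covering covers x with covers (x ∷ʳ not (parity x)) (parity-oddExt x)
  ... | i , C∋ with fromℕ-or-inject₁ i
  ...   | inj₁ refl = x , subst (λ w → C w ≡ true) (flipAt-fromℕ-oddExt x) C∋ ,
                      subst (_≤ 1) (sym (dist-self x)) z≤n
  ...   | inj₂ (j , refl) = flipAt j x , subst (λ w → C w ≡ true) (flipAt-inject₁-oddExt j x) C∋ ,
                            ≤-reflexive (dist-flipAt j x)

  Covering⇒covers-odd : Covering (puncture C) → ∀ y → parity y ≡ true → ∃[ i ] C (flipAt i y) ≡ true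
  Covering⇒covers-odd covering y y-odd with initLast y
  ... | x , b , refl with last-of-odd x b y-odd | covering x
  ...   | refl | c , C∋ , d≤1 with dist≤1⇒ x c d≤1
  ...     | inj₁ refl = fromℕ n , trans (cong C (flipAt-fromℕ-oddExt x)) C∋
  ...     | inj₂ (j , refl) = inject₁ j , trans (cong C (flipAt-inject₁-oddExt j x)) C∋

extension-bit-zero : ∀ {n} {D : Code (suc n)} {C : Code n} {e} →
  (∀ y → (D y ≡ true) ⇔ (∃[ c ] (C c ≡ true × y ≡ c ∷ʳ (e xor parity c)))) → Zeroed D →
  e ≡ false
extension-bit-zero {n} {e = e} D≡ext D∋0 =
  let c , _ , 0≡c∷ = Equivalence.to (D≡ext zeroWord) D∋0
      0≡c , false≡bit = Vec.∷ʳ-injective zeroWord c (trans (sym (zeroWord-∷ʳ n)) 0≡c∷)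
  in begin
    e                 ≡⟨ Bool.xor-identityʳ e ⟨
    e xor false       ≡⟨ cong (e xor_) (trans (sym (parity-zeroWord n)) (cong parity 0≡c)) ⟩
    e xor parity c    ≡⟨ false≡bit ⟨
    false             ∎
  where open ≡-Reasoning

ENP1CC⇒IsEvenCover : ∀ r {D : Code (suc (2 ^ r))} → ENP1CC r D → Zeroed D →
  IsEvenCover (2 ^ r) (2 ^ (2 ^ r ∸ r)) D
ENP1CC⇒IsEvenCover r {D} (C , e , (size-C , covering-C) , D≡ext) D∋0
  with extension-bit-zero {e = e} D≡ext D∋0
... | refl = record
  { codewords-even = D-even
  ; size≡ = trans (sym (size-puncture D-even)) (trans (size-cong puncture≗C) size-C)
  ; covers-odd = Covering⇒covers-odd D-even λ x →
      let c , C∋c , d≤1 = covering-C x in c , trans (puncture≗C c) C∋c , d≤1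
  }
  where
  D-even : EvenCode D
  D-even y D∋y = let c , _ , y≡ = Equivalence.to (D≡ext y) D∋y in trans (cong parity y≡) (parity-evenExt c)

  puncture≗C : ∀ c → puncture D c ≡ C c
  puncture≗C c = Bool.⇔→≡ (mk⇔
    (λ D∋ → let c′ , C∋c′ , c≡c′ = Equivalence.to (D≡ext _) D∋
            in subst (λ w → C w ≡ true) (sym (Vec.∷ʳ-injectiveˡ c c′ c≡c′)) C∋c′)
    (λ C∋c → Equivalence.from (D≡ext _) (c , C∋c , refl)))

IsEvenCover⇒ENP1CC : ∀ r {D : Code (suc (2 ^ r))} → IsEvenCover (2 ^ r) (2 ^ (2 ^ r ∸ r)) D → ENP1CC r D
IsEvenCover⇒ENP1CC r {D} D-cover =
  puncture D , false ,
  (trans (size-puncture codewords-even) size≡ , covers-odd⇒Covering codewords-even covers-odd) ,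
  λ y → mk⇔ (to y) from
  where
  open IsEvenCover D-cover
  to : ∀ y → D y ≡ true → ∃[ c ] (puncture D c ≡ true × y ≡ c ∷ʳ parity c)
  to y D∋y with initLast y
  ... | c , b , refl with last-of-even c b (codewords-even _ D∋y)
  ...   | refl = c , D∋y , refl
  from : ∀ {y} → ∃[ c ] (puncture D c ≡ true × y ≡ c ∷ʳ parity c) → D y ≡ true
  from (c , D∋ , refl) = D∋

-- The diamond completion of an even cover

module DiamondOfEvenCover {n M : ℕ} {D : Code (suc n)} (D-cover : IsEvenCover n M D)
                          (2∣n : 2 ∣ n) (2≤n : 2 ≤ n) (n*M≡2^n : n * M ≡ 2 ^ n) where

  open IsEvenCover D-cover

  surplus : Word (suc n) → ℕ
  surplus y = deg D y ∸ 1

  surplusAround : Word (suc n) → ℕ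
  surplusAround = nbrSum surplus

  ∑D≡M : ∑W (suc n) (toℕ ∘ D) ≡ M
  ∑D≡M = trans (sym (size≡∑W D)) size≡

  deg-odd-pos : ∀ y → parity y ≡ true → 0 < deg D y
  deg-odd-pos y y-odd =
    let i , D∋ = covers-odd y y-odd
    in ≤-trans (≤-reflexive (cong toℕ (sym D∋))) (≤-sum (λ i → toℕ (D (flipAt i y))) i)

  surplus-even : ∀ y → parity y ≡ false → surplus y ≡ 0
  surplus-even y y-even = cong (_∸ 1) (deg-even codewords-even y y-even)

  deg≡parity+surplus : ∀ y → deg D y ≡ toℕ (parity y) + surplus y
  deg≡parity+surplus y with parityView y
  ... | odd p = trans (sym (m+[n∸m]≡n (deg-odd-pos y p))) (cong (λ b → toℕ b + surplus y) (sym p))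
  ... | even p = trans (deg-even codewords-even y p) (sym (cong₂ _+_ (cong toℕ p) (surplus-even y p)))

  deg-odd : ∀ y → parity y ≡ true → deg D y ≡ suc (surplus y)
  deg-odd y y-odd = trans (deg≡parity+surplus y) (cong (λ b → toℕ b + surplus y) y-odd)

  ∑surplus : ∑W (suc n) surplus ≡ M
  ∑surplus = +-cancelˡ-≡ (2 ^ n) _ _ (begin
    2 ^ n + ∑W (suc n) surplus                     ≡⟨ cong (_+ ∑W (suc n) surplus) (∑W-parity n false) ⟨
    ∑W (suc n) (toℕ ∘ parity) + ∑W (suc n) surplus ≡⟨ ∑W-distrib-+ (suc n) (toℕ ∘ parity) surplus ⟨
    ∑W (suc n) (λ y → toℕ (parity y) + surplus y) ≡⟨ ∑W-cong (suc n) deg≡parity+surplus ⟨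
    ∑W (suc n) (deg D)                             ≡⟨ ∑W-nbrSum (suc n) (toℕ ∘ D) ⟩
    suc n * ∑W (suc n) (toℕ ∘ D)                   ≡⟨ cong (suc n *_) ∑D≡M ⟩
    M + n * M                                      ≡⟨ cong (M +_) n*M≡2^n ⟩
    M + 2 ^ n                                      ≡⟨ +-comm M (2 ^ n) ⟩
    2 ^ n + M                                      ∎)
    where open ≡-Reasoning

  nbrSum-deg-even : ∀ u → parity u ≡ false → nbrSum (deg D) u ≡ suc n + surplusAround u
  nbrSum-deg-even u u-even = begin
    nbrSum (deg D) u
      ≡⟨ sum-cong-≗ (λ i → deg≡parity+surplus (flipAt i u)) ⟩
    ∑[ i < suc n ] (toℕ (parity (flipAt i u)) + surplus (flipAt i u))
      ≡⟨ ∑-distrib-+ (λ i → toℕ (parity (flipAt i u))) (λ i → surplus (flipAt i u)) ⟩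
    ∑[ i < suc n ] toℕ (parity (flipAt i u)) + surplusAround u
      ≡⟨ cong (_+ surplusAround u) (sum-cong-≗ (λ i → cong toℕ (parity-flipAt-≡ i u u-even))) ⟩
    ∑[ i < suc n ] 1 + surplusAround u
      ≡⟨ cong (_+ surplusAround u) (trans (sum-const (suc n) 1) (*-identityʳ (suc n))) ⟩
    suc n + surplusAround u ∎
    where open ≡-Reasoning

  -- nbrSum (deg D) u counts the pairs (i , j) with flipAt j (flipAt i u) ∈ D.  For u ∉ D the swap
  -- i ↔ j pairs them off, so the count is even, yet it equals suc n + surplusAround u with n even.
  surplusAround-pos : ∀ u → parity u ≡ false → D u ≡ false → 0 < surplusAround u
  surplusAround-pos u u-even u∉D =
    n≢0⇒n>0 λ B≡0 → contradiction (∣1⇒≡1 (∣m+n∣m⇒∣n (2∣n+1 B≡0) 2∣n)) λ ()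
    where
    2∣n+1 : surplusAround u ≡ 0 → 2 ∣ n + 1
    2∣n+1 B≡0 = let k , eq = nbrSum-nbrSum (toℕ ∘ D) u in divides k (begin
      n + 1                            ≡⟨ +-comm n 1 ⟩
      suc n                            ≡⟨ +-identityʳ (suc n) ⟨
      suc n + 0                        ≡⟨ cong (suc n +_) B≡0 ⟨
      suc n + surplusAround u          ≡⟨ nbrSum-deg-even u u-even ⟨
      nbrSum (deg D) u                 ≡⟨ eq ⟩
      suc n * toℕ (D u) + 2 * k        ≡⟨ cong (λ b → suc n * toℕ b + 2 * k) u∉D ⟩
      suc n * 0 + 2 * k                ≡⟨ cong (_+ 2 * k) (*-zeroʳ (suc n)) ⟩
      2 * k                            ≡⟨ *-comm 2 k ⟩
      k * 2                            ∎)
      where open ≡-Reasoning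

  evenNonCodeword : Word (suc n) → Bool
  evenNonCodeword u = not (D u) ∧ not (parity u)

  ∑evenNonCodeword+M : ∑W (suc n) (toℕ ∘ evenNonCodeword) + M ≡ 2 ^ n
  ∑evenNonCodeword+M = begin
    ∑W (suc n) (toℕ ∘ evenNonCodeword) + M
      ≡⟨ cong (∑W (suc n) (toℕ ∘ evenNonCodeword) +_) ∑D≡M ⟨
    ∑W (suc n) (toℕ ∘ evenNonCodeword) + ∑W (suc n) (toℕ ∘ D)
      ≡⟨ ∑W-distrib-+ (suc n) (toℕ ∘ evenNonCodeword) (toℕ ∘ D) ⟨
    ∑W (suc n) (λ u → toℕ (evenNonCodeword u) + toℕ (D u))
      ≡⟨ ∑W-cong (suc n) even-split ⟩
    ∑W (suc n) (λ u → toℕ (true xor parity u))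
      ≡⟨ ∑W-parity n true ⟩
    2 ^ n ∎
    where
    open ≡-Reasoning
    even-split : ∀ u → toℕ (evenNonCodeword u) + toℕ (D u) ≡ toℕ (not (parity u))
    even-split u with D u in u∈?
    ... | true = cong (toℕ ∘ not) (sym (codewords-even u u∈?))
    ... | false = +-identityʳ _

  evenNonCodeword≤ : ∀ u → toℕ (evenNonCodeword u) ≤ toℕ (not (D u)) * surplusAround u
  evenNonCodeword≤ u with D u in u∈? | parityView u
  ... | true | _ = z≤n
  ... | false | odd p rewrite p = z≤n
  ... | false | even p rewrite p = ≤-trans (surplusAround-pos u p u∈?) (≤-reflexive (sym (+-identityʳ _)))

  2*surplus≤ : ∀ y → 2 * surplus y ≤ deg D y * surplus y
  2*surplus≤ y with surplus y in s≡
  ... | zero = z≤n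
  ... | suc s =
    *-monoˡ-≤ (suc s) (m∸n≢0⇒n<m {deg D y} {1} λ s≡0 → contradiction (trans (sym s≡0) s≡) λ ())

  tight : ∀ u → toℕ (not (D u)) * surplusAround u ≡ toℕ (evenNonCodeword u) ×
                deg D u * surplus u ≡ 2 * surplus u
  tight = ∑W-+-tight (suc n) evenNonCodeword≤ 2*surplus≤ (begin
    ∑W (suc n) offD + ∑W (suc n) (λ y → deg D y * surplus y)
      ≡⟨ cong (∑W (suc n) offD +_) (∑W-*-nbrSum (suc n) (toℕ ∘ D) surplus) ⟨
    ∑W (suc n) offD + ∑W (suc n) onD
      ≡⟨ ∑W-distrib-+ (suc n) offD onD ⟨
    ∑W (suc n) (λ u → offD u + onD u)
      ≡⟨ ∑W-cong (suc n) (λ u → toℕ-not*+toℕ* (D u) (surplusAround u)) ⟩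
    ∑W (suc n) surplusAround
      ≡⟨ ∑W-nbrSum (suc n) surplus ⟩
    suc n * ∑W (suc n) surplus
      ≡⟨ cong (suc n *_) ∑surplus ⟩
    M + n * M
      ≡⟨ cong (M +_) (trans n*M≡2^n (sym ∑evenNonCodeword+M)) ⟩
    M + (X₀ + M)
      ≡⟨ regroup M X₀ ⟩
    X₀ + 2 * M
      ≡⟨ cong (λ s → X₀ + 2 * s) ∑surplus ⟨
    X₀ + 2 * ∑W (suc n) surplus
      ≡⟨ cong (X₀ +_) (∑W-*ˡ (suc n) 2 surplus) ⟨
    X₀ + ∑W (suc n) (λ y → 2 * surplus y) ∎)
    where
    open ≡-Reasoning
    offD onD : Word (suc n) → ℕ
    offD u = toℕ (not (D u)) * surplusAround u
    onD u = toℕ (D u) * surplusAround u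
    X₀ = ∑W (suc n) (toℕ ∘ evenNonCodeword)
    regroup : ∀ M X → M + (X + M) ≡ X + 2 * M
    regroup = solve-∀

  surplusAround-∉ : ∀ u → parity u ≡ false → D u ≡ false → surplusAround u ≡ 1
  surplusAround-∉ u u-even u∉D = begin
    surplusAround u                   ≡⟨ *-identityˡ _ ⟨
    1 * surplusAround u               ≡⟨ cong (λ d → toℕ (not d) * surplusAround u) u∉D ⟨
    toℕ (not (D u)) * surplusAround u ≡⟨ proj₁ (tight u) ⟩
    toℕ (not (D u) ∧ not (parity u))  ≡⟨ cong₂ (λ d p → toℕ (not d ∧ not p)) u∉D u-even ⟩
    1                                 ∎
    where open ≡-Reasoning

  deg≤2 : ∀ y → deg D y ≤ 2
  deg≤2 y with surplus y in s≡
  ... | zero = begin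
    deg D y                    ≡⟨ deg≡parity+surplus y ⟩
    toℕ (parity y) + surplus y ≡⟨ cong (toℕ (parity y) +_) s≡ ⟩
    toℕ (parity y) + 0         ≤⟨ +-monoˡ-≤ 0 (toℕ≤1 (parity y)) ⟩
    1                          ≤⟨ n≤1+n 1 ⟩
    2                          ∎
    where open ≤-Reasoning
  ... | suc s = ≤-reflexive (*-cancelʳ-≡ (deg D y) 2 (suc s)
                  (subst (λ t → deg D y * t ≡ 2 * t) s≡ (proj₂ (tight y))))

  surplus≤1 : ∀ y → surplus y ≤ 1
  surplus≤1 y = ∸-monoˡ-≤ 1 (deg≤2 y)

  -- Otherwise the fourth corner would be an even non-codeword with two neighbours of positive surplus.
  square-closes : ∀ u {i k} → parity u ≡ false → k ≢ i →
    0 < surplus (flipAt i u) → 0 < surplus (flipAt k u) → D (flipAt k (flipAt i u)) ≡ true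
  square-closes u {i} {k} u-even k≢i sᵢ>0 sₖ>0 with D (flipAt k (flipAt i u)) in v∈?
  ... | true = refl
  ... | false = contradiction (begin
    2                                                    ≤⟨ +-mono-≤ sₖ>0 sᵢ>0 ⟩
    surplus (flipAt k u) + surplus (flipAt i u)          ≡⟨ cong₂ (λ a b → surplus a + surplus b) v-i v-k ⟨
    surplus (flipAt i v) + surplus (flipAt k v)          ≤⟨ sum-≥-pair (λ t → surplus (flipAt t v)) k≢i ⟩
    surplusAround v                                      ≡⟨ surplusAround-∉ v v-even v∈? ⟩
    1                                                    ∎) (<-irrefl refl)
    where
    open ≤-Reasoning
    v = flipAt k (flipAt i u)
    v-even : parity v ≡ false
    v-even = parity-flipAt-≡ k (flipAt i u) (parity-flipAt-≡ i u u-even)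
    v-i : flipAt i v ≡ flipAt k u
    v-i = trans (flipAt-comm i k (flipAt i u)) (cong (flipAt k) (flipAt-involutive i u))
    v-k : flipAt k v ≡ flipAt i u
    v-k = flipAt-involutive k (flipAt i u)

  surplusAround-∈-≤2 : ∀ u → D u ≡ true → surplusAround u ≤ 2
  surplusAround-∈-≤2 u u∈D = ≮⇒≥ λ 2<B →
    let i , sᵢ>0 = sum-pos⇒∃ (surplus-via u) (≤-trans (s≤s z≤n) 2<B)
        y = flipAt i u
        j , j≢i , D∋ⱼ = sum>⇒∃-other (D-via y) i
                          (subst (_< deg D y) (sym (D-via-back i)) (2≤deg i sᵢ>0))
        k , k≢i , k≢j , sₖ>0 = sum>⇒∃-third (surplus-via u) i j
                                 (≤-trans (s≤s (+-mono-≤ (surplus≤1 _) (surplus≤1 _))) 2<B)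
        D∋ₖ = square-closes u u-even k≢i sᵢ>0 sₖ>0
    in <-irrefl refl (begin
      3                                   ≤⟨ +-mono-≤ (≤-reflexive (sym (D-via-back i)))
                                               (+-mono-≤ D∋ⱼ (≤-reflexive (cong toℕ (sym D∋ₖ)))) ⟩
      D-via y i + (D-via y j + D-via y k) ≤⟨ sum-≥-triple (D-via y) j≢i k≢i k≢j ⟩
      deg D y                             ≤⟨ deg≤2 y ⟩
      2                                   ∎)
    where
    open ≤-Reasoning
    u-even = codewords-even u u∈D
    surplus-via D-via : Word (suc n) → Fin (suc n) → ℕ
    surplus-via x t = surplus (flipAt t x)
    D-via x t = toℕ (D (flipAt t x))
    D-via-back : ∀ i → D-via (flipAt i u) i ≡ 1
    D-via-back i = trans (cong (toℕ ∘ D) (flipAt-involutive i u)) (cong toℕ u∈D)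
    2≤deg : ∀ i → 0 < surplus (flipAt i u) → 2 ≤ deg D (flipAt i u)
    2≤deg i s>0 = subst (2 ≤_) (sym (deg-odd (flipAt i u) (parity-flipAt-≡ i u u-even))) (s≤s s>0)

  surplusAround-∈ : ∀ u → D u ≡ true → surplusAround u ≡ 2
  surplusAround-∈ u u∈D = begin
    surplusAround u             ≡⟨ *-identityˡ _ ⟨
    1 * surplusAround u         ≡⟨ cong (λ d → toℕ d * surplusAround u) u∈D ⟨
    toℕ (D u) * surplusAround u ≡⟨ ∑W-tight (suc n) ≤2·D ∑≤ u ⟨
    2 * toℕ (D u)               ≡⟨ cong (λ d → 2 * toℕ d) u∈D ⟩
    2                           ∎
    where
    open ≡-Reasoning
    ≤2·D : ∀ u → toℕ (D u) * surplusAround u ≤ 2 * toℕ (D u)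
    ≤2·D u with D u in u∈?
    ... | true = ≤-trans (≤-reflexive (+-identityʳ _)) (surplusAround-∈-≤2 u u∈?)
    ... | false = z≤n
    ∑≤ : ∑W (suc n) (λ u → 2 * toℕ (D u)) ≤ ∑W (suc n) (λ u → toℕ (D u) * surplusAround u)
    ∑≤ = ≤-reflexive (begin
      ∑W (suc n) (λ u → 2 * toℕ (D u))               ≡⟨ ∑W-*ˡ (suc n) 2 (toℕ ∘ D) ⟩
      2 * ∑W (suc n) (toℕ ∘ D)                       ≡⟨ cong (2 *_) (trans ∑D≡M (sym ∑surplus)) ⟩
      2 * ∑W (suc n) surplus                         ≡⟨ ∑W-*ˡ (suc n) 2 surplus ⟨
      ∑W (suc n) (λ y → 2 * surplus y)               ≡⟨ ∑W-cong (suc n) (proj₂ ∘ tight) ⟨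
      ∑W (suc n) (λ y → deg D y * surplus y)         ≡⟨ ∑W-*-nbrSum (suc n) (toℕ ∘ D) surplus ⟨
      ∑W (suc n) (λ u → toℕ (D u) * surplusAround u) ∎)
      where open ≡-Reasoning

  parity+surplusAround : ∀ x → toℕ (parity x) + surplusAround x ≡ suc (toℕ (D x))
  parity+surplusAround x with parityView x
  ... | odd p =
    trans (cong₂ (λ b s → toℕ b + s) p around-odd) (cong (suc ∘ toℕ) (sym (odd⇒∉ codewords-even x p)))
    where
    around-odd : surplusAround x ≡ 0
    around-odd = sum-zero (λ i → surplus (flipAt i x))
                          (λ i → surplus-even (flipAt i x) (parity-flipAt-≡ i x p))
  ... | even p with D x in x∈?
  ...   | true = cong₂ (λ b s → toℕ b + s) p (surplusAround-∈ x x∈?)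
  ...   | false = cong₂ (λ b s → toℕ b + s) p (surplusAround-∉ x p x∈?)

  toℕ-diamondOf : ∀ x → toℕ (diamondOf D x) ≡ toℕ (D x) + surplus x
  toℕ-diamondOf x with parityView x
  ... | even p = trans (cong toℕ (diamondOf-even codewords-even x p))
                       (sym (trans (cong (toℕ (D x) +_) (surplus-even x p)) (+-identityʳ _)))
  ... | odd p = begin
    toℕ (D x ∨ (2 ≤ᵇ deg D x))     ≡⟨ cong (λ b → toℕ (b ∨ (2 ≤ᵇ deg D x))) x∉D ⟩
    toℕ (2 ≤ᵇ deg D x)             ≡⟨ toℕ-2≤ᵇ (deg≤2 x) ⟩
    surplus x                      ≡⟨ cong (λ b → toℕ b + surplus x) x∉D ⟨
    toℕ (D x) + surplus x          ∎
    where
    open ≡-Reasoning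
    x∉D = odd⇒∉ codewords-even x p

  deg-diamondOf : ∀ x → deg (diamondOf D) x ≡ suc (toℕ (diamondOf D x))
  deg-diamondOf x = begin
    deg (diamondOf D) x
      ≡⟨ sum-cong-≗ (λ i → toℕ-diamondOf (flipAt i x)) ⟩
    ∑[ i < suc n ] (toℕ (D (flipAt i x)) + surplus (flipAt i x))
      ≡⟨ ∑-distrib-+ (λ i → toℕ (D (flipAt i x))) (λ i → surplus (flipAt i x)) ⟩
    deg D x + surplusAround x
      ≡⟨ cong (_+ surplusAround x) (deg≡parity+surplus x) ⟩
    toℕ (parity x) + surplus x + surplusAround x
      ≡⟨ xy∙z≈xz∙y (toℕ (parity x)) (surplus x) (surplusAround x) ⟩
    toℕ (parity x) + surplusAround x + surplus x
      ≡⟨ cong (_+ surplus x) (parity+surplusAround x) ⟩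
    suc (toℕ (D x) + surplus x)
      ≡⟨ cong suc (toℕ-diamondOf x) ⟨
    suc (toℕ (diamondOf D x)) ∎
    where open ≡-Reasoning

  size-diamondOf : size (diamondOf D) ≡ 2 * M
  size-diamondOf = begin
    size (diamondOf D)                             ≡⟨ size≡∑W (diamondOf D) ⟩
    ∑W (suc n) (toℕ ∘ diamondOf D)                 ≡⟨ ∑W-cong (suc n) toℕ-diamondOf ⟩
    ∑W (suc n) (λ x → toℕ (D x) + surplus x)       ≡⟨ ∑W-distrib-+ (suc n) (toℕ ∘ D) surplus ⟩
    ∑W (suc n) (toℕ ∘ D) + ∑W (suc n) surplus      ≡⟨ cong₂ _+_ ∑D≡M ∑surplus ⟩
    M + M                                          ≡⟨ cong (M +_) (+-identityʳ M) ⟨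
    2 * M                                          ∎
    where open ≡-Reasoning

  diamondOf-isDiamond : Diamond (suc n) (diamondOf D)
  diamondOf-isDiamond = deg⇒Diamond (u , cong (_∨ (2 ≤ᵇ deg D u)) u∈D) (w , w∉) deg-diamondOf
    where
    y₀-odd : parity (true ∷ zeroWord {n}) ≡ true
    y₀-odd = cong not (parity-zeroWord n)
    i₀ = proj₁ (covers-odd _ y₀-odd)
    u = flipAt i₀ (true ∷ zeroWord)
    u∈D : D u ≡ true
    u∈D = proj₂ (covers-odd _ y₀-odd)
    zero-surplus : ∃[ i ] surplus (flipAt i u) ≡ 0
    zero-surplus = sum<m⇒∃≡0 (λ i → surplus (flipAt i u))
                             (subst (_< suc n) (sym (surplusAround-∈ u u∈D)) (s≤s 2≤n))
    w = flipAt (proj₁ zero-surplus) u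
    w∉D : D w ≡ false
    w∉D = odd⇒∉ codewords-even w (parity-flipAt-≡ (proj₁ zero-surplus) u (codewords-even u u∈D))
    w∉ : diamondOf D w ≡ false
    w∉ = toℕ-zero (trans (toℕ-diamondOf w) (cong₂ (λ b s → toℕ b + s) w∉D (proj₂ zero-surplus)))

-- The even part of a diamond code

module EvenPartOfDiamond {n M : ℕ} {Q : Code (suc n)} (Q-diamond : Diamond (suc n) Q)
                         (size-Q : size Q ≡ 2 * M) (3≤n : 3 ≤ n) where

  deg-Q : ∀ y → deg Q y ≡ suc (toℕ (Q y))
  deg-Q = Diamond⇒deg Q-diamond

  ofParity : Bool → Code (suc n)
  ofParity π y = Q y ∧ not (π xor parity y)

  #ofParity : Bool → ℕ
  #ofParity π = ∑W (suc n) (toℕ ∘ ofParity π)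

  nonCodewordNbrs : ∀ u → Q u ≡ true → nbrSum (toℕ ∘ not ∘ Q) u ≡ n ∸ 1
  nonCodewordNbrs u u∈Q = begin
    nbrSum (toℕ ∘ not ∘ Q) u             ≡⟨ m+n∸n≡m _ 2 ⟨
    nbrSum (toℕ ∘ not ∘ Q) u + 2 ∸ 2     ≡⟨ cong (λ d → nbrSum (toℕ ∘ not ∘ Q) u + d ∸ 2)
                                              (trans (cong (suc ∘ toℕ) (sym u∈Q)) (sym (deg-Q u))) ⟩
    nbrSum (toℕ ∘ not ∘ Q) u + deg Q u ∸ 2 ≡⟨ cong (_∸ 2) (nbrSum-not+deg Q u) ⟩
    suc n ∸ 2                            ∎
    where open ≡-Reasoning

  nbrSum-ofParity : ∀ π y → nbrSum (toℕ ∘ ofParity π) y ≡ toℕ (π xor parity y) * deg Q y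
  nbrSum-ofParity π y = begin
    ∑[ i < suc n ] toℕ (Q (flipAt i y) ∧ not (π xor parity (flipAt i y)))
      ≡⟨ sum-cong-≗ (λ i → cong (λ b → toℕ (Q (flipAt i y) ∧ b)) (flipped-parity i)) ⟩
    ∑[ i < suc n ] toℕ (Q (flipAt i y) ∧ (π xor parity y))
      ≡⟨ sum-cong-≗ (λ i → toℕ-∧ (Q (flipAt i y)) (π xor parity y)) ⟩
    ∑[ i < suc n ] (toℕ (π xor parity y) * toℕ (Q (flipAt i y)))
      ≡⟨ *-distribˡ-sum (toℕ (π xor parity y)) (λ i → toℕ (Q (flipAt i y))) ⟨
    toℕ (π xor parity y) * deg Q y ∎
    where
    open ≡-Reasoning
    flipped-parity : ∀ i → not (π xor parity (flipAt i y)) ≡ π xor parity y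
    flipped-parity i = begin
      not (π xor parity (flipAt i y)) ≡⟨ cong (λ p → not (π xor p)) (parity-flipAt i y) ⟩
      not (π xor not (parity y))      ≡⟨ Bool.not-distribʳ-xor π (not (parity y)) ⟩
      π xor not (not (parity y))      ≡⟨ cong (π xor_) (Bool.not-involutive (parity y)) ⟩
      π xor parity y                  ∎
    toℕ-∧ : ∀ a b → toℕ (a ∧ b) ≡ toℕ b * toℕ a
    toℕ-∧ false b = sym (*-zeroʳ (toℕ b))
    toℕ-∧ true b = sym (*-identityʳ (toℕ b))

  -- Count the edges between the codewords of parity π and the non-codewords from both ends: such a
  -- codeword has n ∸ 1 non-codeword neighbours, a non-codeword of the other parity one codeword neighbour.
  edges : ∀ π → (n ∸ 1) * #ofParity π ≡ ∑W (suc n) (λ y → toℕ (not (Q y) ∧ (π xor parity y)))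
  edges π = begin
    (n ∸ 1) * #ofParity π
      ≡⟨ ∑W-*ˡ (suc n) (n ∸ 1) (toℕ ∘ ofParity π) ⟨
    ∑W (suc n) (λ u → (n ∸ 1) * toℕ (ofParity π u))
      ≡⟨ ∑W-cong (suc n) from-codewords ⟩
    ∑W (suc n) (λ u → toℕ (ofParity π u) * nbrSum (toℕ ∘ not ∘ Q) u)
      ≡⟨ ∑W-*-nbrSum (suc n) (toℕ ∘ ofParity π) (toℕ ∘ not ∘ Q) ⟩
    ∑W (suc n) (λ y → nbrSum (toℕ ∘ ofParity π) y * toℕ (not (Q y)))
      ≡⟨ ∑W-cong (suc n) from-non-codewords ⟩
    ∑W (suc n) (λ y → toℕ (not (Q y) ∧ (π xor parity y))) ∎
    where
    open ≡-Reasoning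
    from-codewords : ∀ u →
      (n ∸ 1) * toℕ (ofParity π u) ≡ toℕ (ofParity π u) * nbrSum (toℕ ∘ not ∘ Q) u
    from-codewords u with Q u in u∈Q
    ... | false = *-zeroʳ (n ∸ 1)
    ... | true = trans (*-comm (n ∸ 1) _) (cong (toℕ (not (π xor parity u)) *_) (sym (nonCodewordNbrs u u∈Q)))
    from-non-codewords : ∀ y →
      nbrSum (toℕ ∘ ofParity π) y * toℕ (not (Q y)) ≡ toℕ (not (Q y) ∧ (π xor parity y))
    from-non-codewords y =
      trans (cong (_* toℕ (not (Q y))) (trans (nbrSum-ofParity π y) (cong (toℕ (π xor parity y) *_) (deg-Q y))))
            (single-nbr (Q y) (π xor parity y))
      where
      single-nbr : ∀ q t → toℕ t * suc (toℕ q) * toℕ (not q) ≡ toℕ (not q ∧ t)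
      single-nbr true t = *-zeroʳ (toℕ t * 2)
      single-nbr false false = refl
      single-nbr false true = refl

  count : ∀ π → (n ∸ 1) * #ofParity π + #ofParity (not π) ≡ 2 ^ n
  count π = begin
    (n ∸ 1) * #ofParity π + #ofParity (not π)
      ≡⟨ cong (_+ #ofParity (not π)) (edges π) ⟩
    ∑W (suc n) (λ y → toℕ (not (Q y) ∧ (π xor parity y))) + #ofParity (not π)
      ≡⟨ ∑W-distrib-+ (suc n) (λ y → toℕ (not (Q y) ∧ (π xor parity y))) (toℕ ∘ ofParity (not π)) ⟨
    ∑W (suc n) (λ y → toℕ (not (Q y) ∧ (π xor parity y)) + toℕ (ofParity (not π) y))
      ≡⟨ ∑W-cong (suc n) (λ y → split (Q y) π (parity y)) ⟩
    ∑W (suc n) (λ y → toℕ (π xor parity y))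
      ≡⟨ ∑W-parity n π ⟩
    2 ^ n ∎
    where
    open ≡-Reasoning
    split : ∀ q π p → toℕ (not q ∧ (π xor p)) + toℕ (q ∧ not (not π xor p)) ≡ toℕ (π xor p)
    split false false false = refl
    split false false true = refl
    split false true false = refl
    split false true true = refl
    split true false false = refl
    split true false true = refl
    split true true false = refl
    split true true true = refl

  #ofParity-sum : #ofParity false + #ofParity true ≡ 2 * M
  #ofParity-sum = begin
    #ofParity false + #ofParity true
      ≡⟨ ∑W-distrib-+ (suc n) (toℕ ∘ ofParity false) (toℕ ∘ ofParity true) ⟨
    ∑W (suc n) (λ y → toℕ (ofParity false y) + toℕ (ofParity true y))
      ≡⟨ ∑W-cong (suc n) (λ y → split (Q y) (parity y)) ⟩
    ∑W (suc n) (toℕ ∘ Q)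
      ≡⟨ trans (sym (size≡∑W Q)) size-Q ⟩
    2 * M ∎
    where
    open ≡-Reasoning
    split : ∀ q p → toℕ (q ∧ not p) + toℕ (q ∧ not (not p)) ≡ toℕ q
    split false _ = refl
    split true false = refl
    split true true = refl

  #even≡M : #ofParity false ≡ M
  #even≡M =
    *-cancelˡ-≡ _ M 2 (trans (cong (#ofParity false +_) (trans (+-identityʳ _) #even≡#odd)) #ofParity-sum)
    where
    #even≡#odd : #ofParity false ≡ #ofParity true
    #even≡#odd = crossed-cancel (n ∸ 1) (∸-monoˡ-≤ 1 3≤n) (trans (count false) (sym (count true)))

  evenPart-isEvenCover : IsEvenCover n M (evenPart Q)
  evenPart-isEvenCover = record
    { codewords-even = evenPart-isEven
    ; size≡ = trans (size≡∑W (evenPart Q)) #even≡M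
    ; covers-odd = λ y y-odd →
        let i , Q∋ = sum-pos⇒∃ (λ i → toℕ (Q (flipAt i y))) (subst (0 <_) (sym (deg-Q y)) z<s)
        in i , trans (evenPart-even {C = Q} (flipAt i y) (parity-flipAt-≡ i y y-odd)) (toℕ-pos Q∋)
    }

module Correspondence (r : ℕ) (2≤r : 2 ≤ r) where

  3≤2^r : 3 ≤ 2 ^ r
  3≤2^r = ≤-trans (n≤1+n 3) (^-monoʳ-≤ 2 2≤r)

  toDiamond : Setoid.Carrier (ZeroedENP1CCs r) → Setoid.Carrier (ZeroedDiamonds r)
  toDiamond (D , D-enp , D∋0) =
    diamondOf D , diamondOf-isDiamond , cong (_∨ (2 ≤ᵇ deg D zeroWord)) D∋0 , size-diamondOf
    where open DiamondOfEvenCover (ENP1CC⇒IsEvenCover r D-enp D∋0) (2∣2^r (≤-trans (n≤1+n 1) 2≤r))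
                                  (≤-trans (n≤1+n 2) 3≤2^r) (2^r*2^[2^r∸r]≡2^2^r r)

  fromDiamond : Setoid.Carrier (ZeroedDiamonds r) → Setoid.Carrier (ZeroedENP1CCs r)
  fromDiamond (Q , Q-diamond , Q∋0 , size-Q) =
    evenPart Q , IsEvenCover⇒ENP1CC r evenPart-isEvenCover ,
    cong₂ (λ q p → q ∧ not p) Q∋0 (parity-zeroWord (suc (2 ^ r)))
    where open EvenPartOfDiamond {M = 2 ^ (2 ^ r ∸ r)} Q-diamond size-Q 3≤2^r

proposition1 : (r : ℕ) → 2 ≤ r → Bijection (ZeroedENP1CCs r) (ZeroedDiamonds r)
proposition1 r 2≤r = Inverse⇒Bijection (record
  { to = toDiamond
  ; from = fromDiamond
  ; to-cong = diamondOf-cong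
  ; from-cong = evenPart-cong
  ; inverse =
      (λ {(_ , Q-diamond , _)} D≈evenPart-Q y →
         trans (diamondOf-cong D≈evenPart-Q y) (diamondOf-evenPart (Diamond⇒deg Q-diamond) y)) ,
      (λ {(_ , D-enp , D∋0)} Q≈diamondOf-D y →
         trans (evenPart-cong Q≈diamondOf-D y) (evenPart-diamondOf (codewords-even D-enp D∋0) y))
  })
  where
  open Correspondence r 2≤r
  codewords-even : ∀ {D} → ENP1CC r D → Zeroed D → EvenCode D
  codewords-even D-enp D∋0 = IsEvenCover.codewords-even (ENP1CC⇒IsEvenCover r D-enp D∋0)
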